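{- Let $G$ be a finite simple graph which is edge critical, connected and triangle-free, and let $v\in V(G)$. (a) If $v$ has valency $2$, then $G_v$ is nonempty and connected. (b) If $v$ has valency $3$, $G_v$ is the disjoint union $G'+G''$ of two nonempty graphs with no edges between them, $G'$ is strongly $s'$-stable and $G''$ is strongly $s''$-stable, then $d^2(v)\ge s'+s''+6$.
   Context: $G=(V,E)$ is edge critical if $\alpha((V,E'))>\alpha(G)$ for every proper subset $E'\subsetneq E$, where $\alpha$ is the independence number. $G_v$ is the subgraph induced on $V$ minus $v$ and its neighbours. $d^2(v)$ is the sum of the valencies (in $G$) of the neighbours of $v$. A destabiliser of a graph $H$ is a vertex subset $M$ such that the subgraph induced on $V(H)\setminus M$ has independence number less than $\alpha(H)$. $H$ is $s$-stable if it has no destabiliser of size $\le s$, and strongly $s$-stable if moreover no independent set of size $s+1$ is a destabiliser. -}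

module Defs where

open import Data.Nat using (ℕ; zero; suc; _+_; _⊔_)
open import Data.Bool using (Bool; true; false; if_then_else_)
open import Data.Bool.Properties using () renaming (_≟_ to _≟ᵇ_)
open import Data.Fin using (Fin)
open import Data.Fin.Properties using (all?)
open import Data.Fin.Subset using (Subset; _∈_; _⊆_; ∣_∣; outside; inside; ⁅_⁆; _∪_; ∁; _─_; ⊤)
open import Data.Fin.Subset.Properties using (_∈?_; _⊆?_)
open import Data.Vec using (Vec; []; _∷_; tabulate)
import Data.Vec as Vec
open import Data.List using (List; []; _∷_; _++_; map; filter; foldr)
open import Data.Product using (_×_; Σ; ∃; _,_)
open import Relation.Nullary using (¬_; Dec)
open import Relation.Nullary.Decidable using (_→-dec_; _×-dec_)
open import Relation.Binary.PropositionalEquality using (_≡_)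

record Graph (n : ℕ) : Set where
  field
    adj    : Fin n → Fin n → Bool
    sym    : ∀ x y → adj x y ≡ adj y x
    irrefl : ∀ x → adj x x ≡ false
open Graph public

module _ {n : ℕ} (G : Graph n) where

  Independent : Subset n → Set
  Independent S = ∀ x y → x ∈ S → y ∈ S → adj G x y ≡ false

  independent? : (S : Subset n) → Dec (Independent S)
  independent? S = all? λ x → all? λ y →
    (x ∈? S) →-dec ((y ∈? S) →-dec (adj G x y ≟ᵇ false))

allSubsets : (n : ℕ) → List (Subset n)
allSubsets zero = [] ∷ []
allSubsets (suc n) =
  map (outside ∷_) (allSubsets n) ++ map (inside ∷_) (allSubsets n)

module _ {n : ℕ} (G : Graph n) where

  -- Independence number of the induced subgraph G[U]:
  -- maximum size of an independent set of G contained in U.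
  α : Subset n → ℕ
  α U = foldr _⊔_ 0 (map ∣_∣
          (filter (λ S → (S ⊆? U) ×-dec independent? G S) (allSubsets n)))

  data Walk (U : Subset n) : Fin n → Fin n → Set where
    here : ∀ {x} → x ∈ U → Walk U x x
    step : ∀ {x y z} → x ∈ U → adj G x y ≡ true → Walk U y z → Walk U x z

  Connected : Subset n → Set
  Connected U = ∀ x y → x ∈ U → y ∈ U → Walk U x y

  TriangleFree : Set
  TriangleFree = ∀ x y z →
    ¬ (adj G x y ≡ true × adj G y z ≡ true × adj G x z ≡ true)

  N : Fin n → Subset n
  N v = tabulate (adj G v)

  deg : Fin n → ℕ
  deg v = ∣ N v ∣

  -- vertex set of G_v : V minus v and its neighbours
  Vv : Fin n → Subset n
  Vv v = ∁ (⁅ v ⁆ ∪ N v)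

  d² : Fin n → ℕ
  d² v = Vec.sum (tabulate (λ u → if adj G v u then deg u else 0))

  Destabiliser : Subset n → Subset n → Set
  Destabiliser U M = M ⊆ U × α (U ─ M) Data.Nat.< α U

  Stable : ℕ → Subset n → Set
  Stable s U = ∀ M → M ⊆ U → ∣ M ∣ Data.Nat.≤ s → ¬ Destabiliser U M

  StronglyStable : ℕ → Subset n → Set
  StronglyStable s U = Stable s U ×
    (∀ M → M ⊆ U → Independent G M → ∣ M ∣ ≡ suc s → ¬ Destabiliser U M)

-- G is edge critical: deleting any nonempty set of edges (i.e. passing to
-- any spanning subgraph H with strictly fewer edges) increases α.
EdgeCritical : ∀ {n} → Graph n → Set
EdgeCritical {n} G = (H : Graph n) →
  (∀ x y → adj H x y ≡ true → adj G x y ≡ true) →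
  (∃ λ x → ∃ λ y → adj G x y ≡ true × adj H x y ≡ false) →
  α G ⊤ Data.Nat.< α H ⊤

module Submission where

-- Lower bounds on α(G) come from packing: an independent set of K (or {v})
-- together with an independent set of G[W] avoiding its neighbours is
-- independent.  Upper bounds come from edge-criticality in the form: deleting
-- the edges between two vertex sets S₁, S₂ (at least one) produces a set of
-- size > α(G) whose only edges run between S₁ and S₂.  At an edge va this gives
-- α(G) = 1 + α(G_v), and removing N(a) alone never lowers α on G_v or its parts.
-- For a split G_v = A + B without edges between the parts, deleting all K–B
-- edges shows that A cannot "absorb" K while B is nonempty; hence every
-- nonempty part loses independence number when N(K) is removed.
--  (a) If ∣K∣ = 2, such a loss already means absorbing, so G_v has no split into
--      two nonempty parts and is therefore connected; it is nonempty since
--      α(G) ≥ ∣K∣ = 2 while α(G) = 1 + α(G_v).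
--  (b) If ∣K∣ = 3, stability turns each loss into a count of edges from K into
--      the part; one part loses at two of the pairs K − w, which gives s + 2
--      edges there and s + 1 on the other side, and d²(v) ≥ 3 + all of them.

open import Defs hiding (sym)
open import Data.Nat using (ℕ; zero; suc; _+_; _⊔_; _≤_; _<_; z≤n; s≤s)
open import Data.Nat.Properties
open import Data.Nat.Tactic.RingSolver using (solve-∀)
open import Algebra.Properties.CommutativeSemigroup +-commutativeSemigroup using (interchange; x∙yz≈y∙xz)
open import Data.Bool using (Bool; true; false; _∧_; not; if_then_else_)
import Data.Bool as Bool
open import Data.Bool.Properties using (∧-identityʳ; ∧-zeroʳ)
open import Data.Fin using (Fin; zero; suc)
import Data.Fin as Fin
open import Data.Fin.Properties using (any?)
open import Data.Fin.Subset
open import Data.Fin.Subset.Properties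
open import Data.Vec using ([]; _∷_; tabulate; here; there)
import Data.Vec as Vec
open import Data.Vec.Properties using ([]=⇒lookup; lookup⇒[]=; lookup∘tabulate)
open import Data.List using (List; map; filter)
open import Data.List.Properties using (foldr-preservesᵒ)
import Data.List.Relation.Unary.Any as Any
open import Data.List.Membership.Propositional using () renaming (_∈_ to _∈ₗ_)
open import Data.List.Membership.Propositional.Properties
  using (∈-map⁺; ∈-map⁻; ∈-filter⁺; ∈-filter⁻; ∈-++⁺ˡ; ∈-++⁺ʳ; foldr-selective)
open import Data.List.Relation.Unary.Any using () renaming (here to hereₗ; there to thereₗ)
open import Data.Product using (_×_; ∃; ∃₂; _,_; proj₁; proj₂)
import Data.Product as Product
open import Data.Sum using (_⊎_; inj₁; inj₂; [_,_]′)
import Data.Sum as Sum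
open import Data.Empty using (⊥-elim) renaming (⊥ to Void)
open import Function using (_∘_)
open import Relation.Nullary using (¬_; Dec; yes; no; does; contradiction)
open import Relation.Nullary.Decidable using (_×-dec_; _⊎-dec_; dec-true; dec-false)
open import Relation.Binary.PropositionalEquality

∈-tabulate⁺ : ∀ {n} (f : Fin n → Bool) {x} → f x ≡ true → x ∈ tabulate f
∈-tabulate⁺ f {x} fx = lookup⇒[]= x (tabulate f) (trans (lookup∘tabulate f x) fx)

∈-tabulate⁻ : ∀ {n} (f : Fin n → Bool) {x} → x ∈ tabulate f → f x ≡ true
∈-tabulate⁻ f {x} x∈ = trans (sym (lookup∘tabulate f x)) ([]=⇒lookup x∈)

does-true : ∀ {P : Set} (P? : Dec P) → does P? ≡ true → P
does-true (yes p) _ = p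

does-⇔ : ∀ {P Q : Set} → (P → Q) → (Q → P) → (P? : Dec P) (Q? : Dec Q) → does P? ≡ does Q?
does-⇔ P→Q Q→P (yes p) Q? = sym (dec-true Q? (P→Q p))
does-⇔ P→Q Q→P (no ¬p) Q? = sym (dec-false Q? (¬p ∘ Q→P))

∣p∪q∣≤∣p∣+∣q∣ : ∀ {n} (p q : Subset n) → ∣ p ∪ q ∣ ≤ ∣ p ∣ + ∣ q ∣
∣p∪q∣≤∣p∣+∣q∣ []          []          = z≤n
∣p∪q∣≤∣p∣+∣q∣ (false ∷ p) (false ∷ q) = ∣p∪q∣≤∣p∣+∣q∣ p q
∣p∪q∣≤∣p∣+∣q∣ (false ∷ p) (true ∷ q)  =
  subst (suc ∣ p ∪ q ∣ ≤_) (sym (+-suc ∣ p ∣ ∣ q ∣)) (s≤s (∣p∪q∣≤∣p∣+∣q∣ p q))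
∣p∪q∣≤∣p∣+∣q∣ (true ∷ p)  (false ∷ q) = s≤s (∣p∪q∣≤∣p∣+∣q∣ p q)
∣p∪q∣≤∣p∣+∣q∣ (true ∷ p)  (true ∷ q)  =
  s≤s (≤-trans (∣p∪q∣≤∣p∣+∣q∣ p q) (≤-trans (n≤1+n _) (≤-reflexive (sym (+-suc ∣ p ∣ ∣ q ∣)))))

∣p∪q∣≡∣p∣+∣q∣ : ∀ {n} (p q : Subset n) → (∀ {x} → x ∈ p → x ∉ q) → ∣ p ∪ q ∣ ≡ ∣ p ∣ + ∣ q ∣
∣p∪q∣≡∣p∣+∣q∣ []          []          _ = refl
∣p∪q∣≡∣p∣+∣q∣ (false ∷ p) (false ∷ q) d = ∣p∪q∣≡∣p∣+∣q∣ p q (λ x∈p x∈q → d (there x∈p) (there x∈q))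
∣p∪q∣≡∣p∣+∣q∣ (false ∷ p) (true ∷ q)  d =
  trans (cong suc (∣p∪q∣≡∣p∣+∣q∣ p q (λ x∈p x∈q → d (there x∈p) (there x∈q))))
        (sym (+-suc ∣ p ∣ ∣ q ∣))
∣p∪q∣≡∣p∣+∣q∣ (true ∷ p)  (false ∷ q) d =
  cong suc (∣p∪q∣≡∣p∣+∣q∣ p q (λ x∈p x∈q → d (there x∈p) (there x∈q)))
∣p∪q∣≡∣p∣+∣q∣ (true ∷ p)  (true ∷ q)  d = ⊥-elim (d here here)

∣p∣≤∣q∣+∣r∣ : ∀ {n} {p q r : Subset n} → (∀ {x} → x ∈ p → x ∈ q ⊎ x ∈ r) → ∣ p ∣ ≤ ∣ q ∣ + ∣ r ∣
∣p∣≤∣q∣+∣r∣ {q = q} {r} cover = ≤-trans (p⊆q⇒∣p∣≤∣q∣ (x∈p∪q⁺ ∘ cover)) (∣p∪q∣≤∣p∣+∣q∣ q r)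

∣p∣≡1+∣p-x∣ : ∀ {n} {p : Subset n} {x} → x ∈ p → ∣ p ∣ ≡ suc ∣ p - x ∣
∣p∣≡1+∣p-x∣ {p = true ∷ p}  here = cong suc (sym (cong ∣_∣ (p─⊥≡p p)))
∣p∣≡1+∣p-x∣ {p = false ∷ p} (there x∈p) = ∣p∣≡1+∣p-x∣ x∈p
∣p∣≡1+∣p-x∣ {p = true ∷ p}  (there x∈p) = cong suc (∣p∣≡1+∣p-x∣ x∈p)

∣p-x∣≡k : ∀ {n} {p : Subset n} {x k} → x ∈ p → ∣ p ∣ ≡ suc k → ∣ p - x ∣ ≡ k
∣p-x∣≡k x∈p ∣p∣≡1+k = suc-injective (trans (sym (∣p∣≡1+∣p-x∣ x∈p)) ∣p∣≡1+k)

∣p∣≡0⇒x∉p : ∀ {n} {p : Subset n} {x} → ∣ p ∣ ≡ 0 → x ∉ p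
∣p∣≡0⇒x∉p ∣p∣≡0 x∈p = 0≢1+n (trans (sym ∣p∣≡0) (∣p∣≡1+∣p-x∣ x∈p))

Empty⇒∣p∣≡0 : ∀ {n} {p : Subset n} → Empty p → ∣ p ∣ ≡ 0
Empty⇒∣p∣≡0 {n} empty = trans (cong ∣_∣ (Empty-unique empty)) (∣⊥∣≡0 n)

size-nonempty : ∀ {n} {p : Subset n} {k} → ∣ p ∣ ≡ suc k → Nonempty p
size-nonempty {p = p} ∣p∣≡1+k with nonempty? p
... | yes nonempty = nonempty
... | no empty     = ⊥-elim (0≢1+n (trans (sym (Empty⇒∣p∣≡0 empty)) ∣p∣≡1+k))

x∈p─q⁻ : ∀ {n} {p q : Subset n} {x} → x ∈ p ─ q → x ∈ p × x ∉ q
x∈p─q⁻ {p = p} {q} x∈p─q = p─q⊆p p q x∈p─q , x∉q x∈p─q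
  where
  x∉q : ∀ {n} {p q : Subset n} {x} → x ∈ p ─ q → x ∉ q
  x∉q {p = _ ∷ _} {true ∷ _}  {zero} ()
  x∉q {p = _ ∷ _} {false ∷ _} {zero} _ ()
  x∉q {p = _ ∷ _} {_ ∷ _} {suc _} (there x∈p─q) (there x∈q) = x∉q x∈p─q x∈q

─-anti : ∀ {n} (p : Subset n) {q r : Subset n} → q ⊆ r → p ─ r ⊆ p ─ q
─-anti p q⊆r x∈p─r =
  let x∈p , x∉r = x∈p─q⁻ x∈p─r in x∈p∧x∉q⇒x∈p─q x∈p (x∉r ∘ q⊆r)

∣p∣≡1⇒⊆⁅x⁆ : ∀ {n} {p : Subset n} → ∣ p ∣ ≡ 1 → ∃ λ x → x ∈ p × p ⊆ ⁅ x ⁆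
∣p∣≡1⇒⊆⁅x⁆ {p = p} ∣p∣≡1 with size-nonempty ∣p∣≡1
... | x , x∈p = x , x∈p , p⊆⁅x⁆
  where
  p⊆⁅x⁆ : p ⊆ ⁅ x ⁆
  p⊆⁅x⁆ {y} y∈p with y Fin.≟ x
  ... | yes refl = x∈⁅x⁆ x
  ... | no y≢x = ⊥-elim (∣p∣≡0⇒x∉p (∣p-x∣≡k x∈p ∣p∣≡1) (x∈p∧x≢y⇒x∈p-y y∈p y≢x))

⊆-by-size : ∀ {n} {p q : Subset n} → p ⊆ q → ∣ q ∣ ≤ ∣ p ∣ → q ⊆ p
⊆-by-size {p = p} {q} p⊆q ∣q∣≤∣p∣ {z} z∈q with z ∈? p
... | yes z∈p = z∈p
... | no z∉p = ⊥-elim (<⇒≱ ∣p∣<∣q∣ ∣q∣≤∣p∣)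
  where
  p⊆q-z : p ⊆ q - z
  p⊆q-z {y} y∈p = x∈p∧x≢y⇒x∈p-y (p⊆q y∈p) (λ { refl → z∉p y∈p })
  ∣p∣<∣q∣ : ∣ p ∣ < ∣ q ∣
  ∣p∣<∣q∣ = ≤-trans (s≤s (p⊆q⇒∣p∣≤∣q∣ p⊆q-z)) (≤-reflexive (sym (∣p∣≡1+∣p-x∣ z∈q)))

three-elements : ∀ {n} {p : Subset n} → ∣ p ∣ ≡ 3 →
  ∃ λ a → ∃ λ b → ∃ λ c → a ∈ p × b ∈ p × c ∈ p × a ≢ b × a ≢ c × b ≢ c
three-elements {p = p} ∣p∣≡3
  with size-nonempty ∣p∣≡3
... | a , a∈p
  with size-nonempty (∣p-x∣≡k a∈p ∣p∣≡3)
... | b , b∈p-a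
  with size-nonempty (∣p-x∣≡k b∈p-a (∣p-x∣≡k a∈p ∣p∣≡3))
... | c , c∈p-a-b =
  let b∈p , b∉⁅a⁆ = x∈p─q⁻ b∈p-a
      c∈p-a , c∉⁅b⁆ = x∈p─q⁻ c∈p-a-b
      c∈p , c∉⁅a⁆ = x∈p─q⁻ c∈p-a
  in a , b , c , a∈p , b∈p , c∈p
   , (λ a≡b → b∉⁅a⁆ (subst (_∈ ⁅ a ⁆) a≡b (x∈⁅x⁆ a)))
   , (λ a≡c → c∉⁅a⁆ (subst (_∈ ⁅ a ⁆) a≡c (x∈⁅x⁆ a)))
   , (λ b≡c → c∉⁅b⁆ (subst (_∈ ⁅ b ⁆) b≡c (x∈⁅x⁆ b)))

sumOver : ∀ {n} → Subset n → (Fin n → ℕ) → ℕ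
sumOver []      f = 0
sumOver (b ∷ p) f = (if b then f zero else 0) + sumOver p (f ∘ suc)

sumOver-tabulate : ∀ {n} (χ : Fin n → Bool) (f : Fin n → ℕ) →
  sumOver (tabulate χ) f ≡ Vec.sum (tabulate (λ u → if χ u then f u else 0))
sumOver-tabulate {zero}  χ f = refl
sumOver-tabulate {suc n} χ f = cong ((if χ zero then f zero else 0) +_) (sumOver-tabulate (χ ∘ suc) (f ∘ suc))

sumOver-remove : ∀ {n} {p : Subset n} {x} (f : Fin n → ℕ) → x ∈ p →
  sumOver p f ≡ f x + sumOver (p - x) f
sumOver-remove {p = true ∷ p} f here = cong (λ q → f zero + sumOver q (f ∘ suc)) (sym (p─⊥≡p p))
sumOver-remove {p = false ∷ p} f (there x∈p) = sumOver-remove (f ∘ suc) x∈p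
sumOver-remove {p = true ∷ p} {suc x} f (there x∈p) = begin
  f zero + sumOver p (f ∘ suc)                   ≡⟨ cong (f zero +_) (sumOver-remove (f ∘ suc) x∈p) ⟩
  f zero + (f (suc x) + sumOver (p - x) (f ∘ suc)) ≡⟨ x∙yz≈y∙xz (f zero) (f (suc x)) _ ⟩
  f (suc x) + (f zero + sumOver (p - x) (f ∘ suc)) ∎
  where open ≡-Reasoning

sumOver-mono : ∀ {n} (p : Subset n) {f g : Fin n → ℕ} → (∀ {u} → u ∈ p → f u ≤ g u) →
  sumOver p f ≤ sumOver p g
sumOver-mono []          f≤g = z≤n
sumOver-mono (true ∷ p)  f≤g = +-mono-≤ (f≤g here) (sumOver-mono p (f≤g ∘ there))
sumOver-mono (false ∷ p) f≤g = sumOver-mono p (f≤g ∘ there)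

sumOver-+ : ∀ {n} (p : Subset n) (f g : Fin n → ℕ) →
  sumOver p (λ u → f u + g u) ≡ sumOver p f + sumOver p g
sumOver-+ []          f g = refl
sumOver-+ (false ∷ p) f g = sumOver-+ p (f ∘ suc) (g ∘ suc)
sumOver-+ (true ∷ p)  f g =
  trans (cong (f zero + g zero +_) (sumOver-+ p (f ∘ suc) (g ∘ suc)))
        (interchange (f zero) (g zero) (sumOver p (f ∘ suc)) (sumOver p (g ∘ suc)))

sumOver-1 : ∀ {n} (p : Subset n) → sumOver p (λ _ → 1) ≡ ∣ p ∣
sumOver-1 []          = refl
sumOver-1 (true ∷ p)  = cong suc (sumOver-1 p)
sumOver-1 (false ∷ p) = sumOver-1 p

allSubsets-complete : ∀ n (S : Subset n) → S ∈ₗ allSubsets n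
allSubsets-complete zero    []          = hereₗ refl
allSubsets-complete (suc n) (false ∷ S) = ∈-++⁺ˡ (∈-map⁺ (false ∷_) (allSubsets-complete n S))
allSubsets-complete (suc n) (true ∷ S)  =
  ∈-++⁺ʳ (map (false ∷_) (allSubsets n)) (∈-map⁺ (true ∷_) (allSubsets-complete n S))

module GraphFacts {n} (G : Graph n) where

  adj-sym : ∀ {x y} → adj G x y ≡ false → adj G y x ≡ false
  adj-sym {x} {y} e = trans (Graph.sym G y x) e

  edge-non-edge : ∀ {x y} → adj G x y ≡ true → adj G x y ≡ false → Void
  edge-non-edge xy ¬xy with () ← trans (sym xy) ¬xy

  adj-false : ∀ {x y} → (adj G x y ≡ true → Void) → adj G x y ≡ false
  adj-false {x} {y} ¬xy with adj G x y
  ... | false = refl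
  ... | true  = ⊥-elim (¬xy refl)

  independent-⊆ : ∀ {S T} → S ⊆ T → Independent G T → Independent G S
  independent-⊆ S⊆T T-ind x y x∈S y∈S = T-ind x y (S⊆T x∈S) (S⊆T y∈S)

  independent-∪ : ∀ {S T} → Independent G S → Independent G T →
    (∀ x y → x ∈ S → y ∈ T → adj G x y ≡ false) → Independent G (S ∪ T)
  independent-∪ {S} {T} S-ind T-ind no-edge x y x∈ y∈ with x∈p∪q⁻ S T x∈ | x∈p∪q⁻ S T y∈
  ... | inj₁ x∈S | inj₁ y∈S = S-ind x y x∈S y∈S
  ... | inj₁ x∈S | inj₂ y∈T = no-edge x y x∈S y∈T
  ... | inj₂ x∈T | inj₁ y∈S = adj-sym (no-edge y x y∈S x∈T)
  ... | inj₂ x∈T | inj₂ y∈T = T-ind x y x∈T y∈T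

  candidates : Subset n → List (Subset n)
  candidates U = filter (λ S → (S ⊆? U) ×-dec independent? G S) (allSubsets n)

  α-maximal : ∀ {U S} → S ⊆ U → Independent G S → ∣ S ∣ ≤ α G U
  α-maximal {U} {S} S⊆U S-ind =
    foldr-preservesᵒ {P = ∣ S ∣ ≤_} {f = _⊔_}
      (λ a b → [ m≤n⇒m≤n⊔o b , m≤n⇒m≤o⊔n a ]′) 0 (map ∣_∣ (candidates U))
      (inj₂ (Any.map (λ { refl → ≤-refl })
        (∈-map⁺ ∣_∣ (∈-filter⁺ (λ S → (S ⊆? U) ×-dec independent? G S)
                                (allSubsets-complete n S) (S⊆U , S-ind)))))

  record MaxIndependent (U : Subset n) : Set where
    field
      set         : Subset n
      set⊆U       : set ⊆ U
      independent : Independent G set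
      size        : ∣ set ∣ ≡ α G U

  maxIndependent : ∀ U → MaxIndependent U
  maxIndependent U with foldr-selective ⊔-sel 0 (map ∣_∣ (candidates U))
  ... | inj₁ α≡0 = record
    { set = ⊥ ; set⊆U = λ x∈⊥ → contradiction x∈⊥ ∉⊥
    ; independent = λ x y x∈⊥ _ → contradiction x∈⊥ ∉⊥
    ; size = trans (∣⊥∣≡0 n) (sym α≡0) }
  ... | inj₂ α∈ with ∈-map⁻ ∣_∣ α∈
  ...   | S , S∈ , α≡∣S∣ with ∈-filter⁻ (λ S → (S ⊆? U) ×-dec independent? G S) {xs = allSubsets n} S∈
  ...     | _ , S⊆U , S-ind = record { set = S ; set⊆U = S⊆U ; independent = S-ind ; size = sym α≡∣S∣ }

  α-mono : ∀ {U V} → U ⊆ V → α G U ≤ α G V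
  α-mono {U} U⊆V = let open MaxIndependent (maxIndependent U) in
    subst (_≤ _) size (α-maximal (U⊆V ∘ set⊆U) independent)

  α≤∣U∣ : ∀ U → α G U ≤ ∣ U ∣
  α≤∣U∣ U = let open MaxIndependent (maxIndependent U) in
    subst (_≤ _) size (p⊆q⇒∣p∣≤∣q∣ set⊆U)

  α-subadditive : ∀ {U A B} → (∀ {x} → x ∈ U → x ∈ A ⊎ x ∈ B) → α G U ≤ α G A + α G B
  α-subadditive {U} {A} {B} cover = begin
    α G U                     ≡⟨ sym size ⟩
    ∣ set ∣                   ≤⟨ ∣p∣≤∣q∣+∣r∣ split ⟩
    ∣ set ∩ A ∣ + ∣ set ∩ B ∣ ≤⟨ +-mono-≤ (part A) (part B) ⟩
    α G A + α G B             ∎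
    where
    open ≤-Reasoning
    open MaxIndependent (maxIndependent U)
    split : ∀ {x} → x ∈ set → x ∈ set ∩ A ⊎ x ∈ set ∩ B
    split x∈ = Sum.map (λ x∈A → x∈p∩q⁺ (x∈ , x∈A)) (λ x∈B → x∈p∩q⁺ (x∈ , x∈B)) (cover (set⊆U x∈))
    part : ∀ C → ∣ set ∩ C ∣ ≤ α G C
    part C = α-maximal (p∩q⊆q set C) (independent-⊆ (p∩q⊆p set C) independent)

  α-additive : ∀ {U A B} → A ∪ B ⊆ U → (∀ {x} → x ∈ A → x ∉ B) →
    (∀ x y → x ∈ A → y ∈ B → adj G x y ≡ false) → α G A + α G B ≤ α G U
  α-additive {U} {A} {B} A∪B⊆U disjoint no-edge = begin
    α G A + α G B        ≡⟨ sym (cong₂ _+_ SA.size SB.size) ⟩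
    ∣ SA.set ∣ + ∣ SB.set ∣ ≡⟨ sym (∣p∪q∣≡∣p∣+∣q∣ SA.set SB.set (λ a b → disjoint (SA.set⊆U a) (SB.set⊆U b))) ⟩
    ∣ SA.set ∪ SB.set ∣   ≤⟨ α-maximal (A∪B⊆U ∘ ∪-mono) (independent-∪ SA.independent SB.independent
                               (λ x y a b → no-edge x y (SA.set⊆U a) (SB.set⊆U b))) ⟩
    α G U                ∎
    where
    open ≤-Reasoning
    module SA = MaxIndependent (maxIndependent A)
    module SB = MaxIndependent (maxIndependent B)
    ∪-mono : SA.set ∪ SB.set ⊆ A ∪ B
    ∪-mono x∈ = x∈p∪q⁺ (Sum.map SA.set⊆U SB.set⊆U (x∈p∪q⁻ SA.set SB.set x∈))

  N[_] : Subset n → Subset n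
  N[ P ] = tabulate (λ z → does (any? (λ x → (x ∈? P) ×-dec (adj G x z Bool.≟ true))))

  ∈N[]⁺ : ∀ {P x z} → x ∈ P → adj G x z ≡ true → z ∈ N[ P ]
  ∈N[]⁺ {P} {x} {z} x∈P xz = ∈-tabulate⁺ _ (dec-true (any? _) (x , x∈P , xz))

  ∈N[]⁻ : ∀ {P z} → z ∈ N[ P ] → ∃ λ x → x ∈ P × adj G x z ≡ true
  ∈N[]⁻ {P} {z} z∈ = does-true (any? _) (∈-tabulate⁻ _ z∈)

  N[]-mono : ∀ {P Q} → P ⊆ Q → N[ P ] ⊆ N[ Q ]
  N[]-mono P⊆Q z∈ = let x , x∈P , xz = ∈N[]⁻ z∈ in ∈N[]⁺ (P⊆Q x∈P) xz

  ∣N[P]∩C∣≤Σ : ∀ P C → ∣ N[ P ] ∩ C ∣ ≤ sumOver P (λ u → ∣ N G u ∩ C ∣)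
  ∣N[P]∩C∣≤Σ P C = bound ∣ P ∣ P refl
    where
    f : Fin n → ℕ
    f u = ∣ N G u ∩ C ∣
    bound : ∀ k P → ∣ P ∣ ≡ k → ∣ N[ P ] ∩ C ∣ ≤ sumOver P f
    bound zero P ∣P∣≡0 = ≤-trans (≤-reflexive (Empty⇒∣p∣≡0 no-neighbour)) z≤n
      where
      no-neighbour : Empty (N[ P ] ∩ C)
      no-neighbour (z , z∈) = let x , x∈P , _ = ∈N[]⁻ (proj₁ (x∈p∩q⁻ _ C z∈)) in ∣p∣≡0⇒x∉p ∣P∣≡0 x∈P
    bound (suc k) P ∣P∣≡1+k with size-nonempty ∣P∣≡1+k
    ... | x , x∈P = begin
      ∣ N[ P ] ∩ C ∣                   ≤⟨ ∣p∣≤∣q∣+∣r∣ split ⟩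
      f x + ∣ N[ P - x ] ∩ C ∣         ≤⟨ +-monoʳ-≤ (f x) (bound k (P - x) ∣P-x∣≡k) ⟩
      f x + sumOver (P - x) f          ≡⟨ sym (sumOver-remove {p = P} f x∈P) ⟩
      sumOver P f                      ∎
      where
      open ≤-Reasoning
      ∣P-x∣≡k : ∣ P - x ∣ ≡ k
      ∣P-x∣≡k = ∣p-x∣≡k x∈P ∣P∣≡1+k
      split : ∀ {z} → z ∈ N[ P ] ∩ C → z ∈ N G x ∩ C ⊎ z ∈ N[ P - x ] ∩ C
      split {z} z∈ with x∈p∩q⁻ N[ P ] C z∈
      ... | z∈N[P] , z∈C with ∈N[]⁻ z∈N[P]
      ...   | y , y∈P , yz with y Fin.≟ x
      ...     | yes refl = inj₁ (x∈p∩q⁺ (∈-tabulate⁺ (adj G y) yz , z∈C))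
      ...     | no y≢x  = inj₂ (x∈p∩q⁺ (∈N[]⁺ (x∈p∧x≢y⇒x∈p-y {p = P} y∈P y≢x) yz , z∈C))

  walk-snoc : ∀ {U x y z} → Walk G U x y → adj G y z ≡ true → z ∈ U → Walk G U x z
  walk-snoc (here y∈U)        yz z∈U = step y∈U yz (here z∈U)
  walk-snoc (step x∈U xw wy)  yz z∈U = step x∈U xw (walk-snoc wy yz z∈U)

  walk-exit : ∀ {U} C {y t} → Walk G U y t → y ∈ C → t ∉ C →
    ∃₂ λ x z → x ∈ C × z ∉ C × adj G x z ≡ true
  walk-exit C (here _) y∈C t∉C = ⊥-elim (t∉C y∈C)
  walk-exit C (step {x = y} {y = w} _ yw rest) y∈C t∉C with w ∈? C
  ... | yes w∈C = walk-exit C rest w∈C t∉C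
  ... | no w∉C = y , w , y∈C , w∉C , yw

  record Reachable (U : Subset n) (x : Fin n) (S : Subset n) : Set where
    field
      ⊆U        : S ⊆ U
      ∋x        : x ∈ S
      reachable : ∀ {z} → z ∈ S → Walk G U x z

  reachable-⁅x⁆ : ∀ {U x} → x ∈ U → Reachable U x ⁅ x ⁆
  reachable-⁅x⁆ {U} {x} x∈U = record
    { ⊆U        = λ z∈⁅x⁆ → subst (_∈ U) (sym (x∈⁅y⁆⇒x≡y x z∈⁅x⁆)) x∈U
    ; ∋x        = x∈⁅x⁆ x
    ; reachable = λ z∈⁅x⁆ → subst (Walk G U x) (sym (x∈⁅y⁆⇒x≡y x z∈⁅x⁆)) (here x∈U) }

  reachable-extend : ∀ {U x S z w} → Reachable U x S → z ∈ S → w ∈ U → adj G z w ≡ true →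
    Reachable U x (S ∪ ⁅ w ⁆)
  reachable-extend {U} {x} {S} {z} {w} R z∈S w∈U zw = record
    { ⊆U        = λ y∈ → [ ⊆U , (λ y∈⁅w⁆ → subst (_∈ U) (sym (x∈⁅y⁆⇒x≡y w y∈⁅w⁆)) w∈U) ]′
                           (x∈p∪q⁻ S ⁅ w ⁆ y∈)
    ; ∋x        = x∈p∪q⁺ (inj₁ ∋x)
    ; reachable = λ y∈ → [ reachable , (λ y∈⁅w⁆ → subst (Walk G U x) (sym (x∈⁅y⁆⇒x≡y w y∈⁅w⁆))
                                                        (walk-snoc (reachable z∈S) zw w∈U)) ]′
                           (x∈p∪q⁻ S ⁅ w ⁆ y∈) }
    where open Reachable R

  record Component (U : Subset n) (x : Fin n) : Set where
    field
      members : Subset n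
      reach   : Reachable U x members
      closed  : ∀ {z w} → z ∈ members → w ∈ U → adj G z w ≡ true → w ∈ members

  -- Components exist: grow {x} by frontier vertices until there is none; the
  -- size of U ─ S bounds the number of steps.
  component : ∀ {U x} → x ∈ U → Component U x
  component {U} {x} x∈U = grow n ⁅ x ⁆ (∣p∣≤n (U ─ ⁅ x ⁆)) (reachable-⁅x⁆ x∈U)
    where
    frontier? : ∀ S → Dec (∃ λ w → w ∈ U ─ S × ∃ λ z → z ∈ S × adj G z w ≡ true)
    frontier? S = any? (λ w → (w ∈? U ─ S) ×-dec any? (λ z → (z ∈? S) ×-dec (adj G z w Bool.≟ true)))

    grow : ∀ k S → ∣ U ─ S ∣ ≤ k → Reachable U x S → Component U x
    grow k S size R with frontier? S | k
    ... | no no-frontier | _ = record { members = S ; reach = R ; closed = closed }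
      where
      closed : ∀ {z w} → z ∈ S → w ∈ U → adj G z w ≡ true → w ∈ S
      closed {z} {w} z∈S w∈U zw with w ∈? S
      ... | yes w∈S = w∈S
      ... | no w∉S = ⊥-elim (no-frontier (w , x∈p∧x∉q⇒x∈p─q w∈U w∉S , z , z∈S , zw))
    ... | yes (w , w∈U─S , _) | zero = ⊥-elim (∣p∣≡0⇒x∉p (n≤0⇒n≡0 size) w∈U─S)
    ... | yes (w , w∈U─S , z , z∈S , zw) | suc k =
      grow k (S ∪ ⁅ w ⁆) size′ (reachable-extend R z∈S (proj₁ (x∈p─q⁻ w∈U─S)) zw)
      where
      size′ : ∣ U ─ (S ∪ ⁅ w ⁆) ∣ ≤ k
      size′ = ≤-pred (begin-strict
        ∣ U ─ (S ∪ ⁅ w ⁆) ∣ ≡⟨ cong ∣_∣ (sym (p─q─r≡p─q∪r U S ⁅ w ⁆)) ⟩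
        ∣ (U ─ S) - w ∣     <⟨ x∈p⇒∣p-x∣<∣p∣ w∈U─S ⟩
        ∣ U ─ S ∣           ≤⟨ size ⟩
        suc k               ∎)
        where open ≤-Reasoning

  stable-bound : ∀ {s C X} → Stable G s C → α G (C ─ X) < α G C → s < ∣ X ∩ C ∣
  stable-bound {s} {C} {X} stable drop with ∣ X ∩ C ∣ ≤? s
  ... | no ∣X∩C∣≰s = ≰⇒> ∣X∩C∣≰s
  ... | yes ∣X∩C∣≤s = ⊥-elim (stable (X ∩ C) (p∩q⊆q X C) ∣X∩C∣≤s
                                     (p∩q⊆q X C , ≤-<-trans (α-mono C─X∩C⊆C─X) drop))
    where
    C─X∩C⊆C─X : C ─ (X ∩ C) ⊆ C ─ X
    C─X∩C⊆C─X z∈ = let z∈C , z∉X∩C = x∈p─q⁻ z∈ in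
      x∈p∧x∉q⇒x∈p─q z∈C (λ z∈X → z∉X∩C (x∈p∩q⁺ (z∈X , z∈C)))

module Criticality {n} (G : Graph n) where

  Crossing : Subset n → Subset n → Fin n → Fin n → Set
  Crossing S₁ S₂ x y = (x ∈ S₁ × y ∈ S₂) ⊎ (x ∈ S₂ × y ∈ S₁)

  CutIndependent : Subset n → Subset n → Subset n → Set
  CutIndependent S₁ S₂ T = ∀ x y → x ∈ T → y ∈ T → ¬ Crossing S₁ S₂ x y → adj G x y ≡ false

  cut-independent-inside : ∀ {S₁ S₂ T C} → CutIndependent S₁ S₂ T →
    (∀ {z} → z ∈ C → z ∉ S₁) → Independent G (T ∩ C)
  cut-independent-inside {T = T} {C} cut C∌S₁ x y x∈ y∈ with x∈p∩q⁻ T C x∈ | x∈p∩q⁻ T C y∈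
  ... | x∈T , x∈C | y∈T , y∈C = cut x y x∈T y∈T λ
    { (inj₁ (x∈S₁ , _)) → C∌S₁ x∈C x∈S₁
    ; (inj₂ (_ , y∈S₁)) → C∌S₁ y∈C y∈S₁ }

  critical-cut : EdgeCritical G → ∀ S₁ S₂ → (∃₂ λ x y → x ∈ S₁ × y ∈ S₂ × adj G x y ≡ true) →
    ∃ λ T → CutIndependent S₁ S₂ T × α G ⊤ < ∣ T ∣
  critical-cut critical S₁ S₂ (x₀ , y₀ , x₀∈S₁ , y₀∈S₂ , x₀y₀) = T.set , cut-independent , α<∣T∣
    where
    crossing? : ∀ x y → Dec (Crossing S₁ S₂ x y)
    crossing? x y = ((x ∈? S₁) ×-dec (y ∈? S₂)) ⊎-dec ((x ∈? S₂) ×-dec (y ∈? S₁))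

    crosses : Fin n → Fin n → Bool
    crosses x y = does (crossing? x y)

    crossing-sym : ∀ {x y} → Crossing S₁ S₂ x y → Crossing S₁ S₂ y x
    crossing-sym = Sum.swap ∘ Sum.map Product.swap Product.swap

    crosses-sym : ∀ x y → crosses x y ≡ crosses y x
    crosses-sym x y = does-⇔ crossing-sym crossing-sym (crossing? x y) (crossing? y x)

    H : Graph n
    H = record
      { adj    = λ x y → adj G x y ∧ not (crosses x y)
      ; sym    = λ x y → cong₂ _∧_ (Graph.sym G x y) (cong not (crosses-sym x y))
      ; irrefl = λ x → cong (_∧ not (crosses x x)) (Graph.irrefl G x) }

    H-kept : ∀ x y → ¬ Crossing S₁ S₂ x y → adj H x y ≡ adj G x y
    H-kept x y ¬c = trans (cong (λ b → adj G x y ∧ not b) (dec-false (crossing? x y) ¬c)) (∧-identityʳ _)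

    H-cut : adj H x₀ y₀ ≡ false
    H-cut = trans (cong (λ b → adj G x₀ y₀ ∧ not b) (dec-true (crossing? x₀ y₀) (inj₁ (x₀∈S₁ , y₀∈S₂))))
                  (∧-zeroʳ _)

    H⊆G : ∀ x y → adj H x y ≡ true → adj G x y ≡ true
    H⊆G x y xy with adj G x y
    ... | true = refl

    module H = GraphFacts H
    module T = H.MaxIndependent (H.maxIndependent ⊤)

    cut-independent : CutIndependent S₁ S₂ T.set
    cut-independent x y x∈T y∈T ¬c = trans (sym (H-kept x y ¬c)) (T.independent x y x∈T y∈T)

    α<∣T∣ : α G ⊤ < ∣ T.set ∣
    α<∣T∣ = subst (α G ⊤ <_) (sym T.size) (critical H H⊆G (x₀ , y₀ , x₀y₀ , H-cut))

pigeonhole : ∀ {X : Set} {P Q : X → Set} {a b c : X} → a ≢ b → a ≢ c → b ≢ c →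
  P a ⊎ Q a → P b ⊎ Q b → P c ⊎ Q c →
  ∃₂ λ y z → y ≢ z × ((P y × P z) ⊎ (Q y × Q z))
pigeonhole a≢b a≢c b≢c (inj₁ pa) (inj₁ pb) _         = _ , _ , a≢b , inj₁ (pa , pb)
pigeonhole a≢b a≢c b≢c (inj₂ qa) (inj₂ qb) _         = _ , _ , a≢b , inj₂ (qa , qb)
pigeonhole a≢b a≢c b≢c (inj₁ pa) (inj₂ qb) (inj₁ pc) = _ , _ , a≢c , inj₁ (pa , pc)
pigeonhole a≢b a≢c b≢c (inj₁ pa) (inj₂ qb) (inj₂ qc) = _ , _ , b≢c , inj₂ (qb , qc)
pigeonhole a≢b a≢c b≢c (inj₂ qa) (inj₁ pb) (inj₁ pc) = _ , _ , b≢c , inj₁ (pb , pc)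
pigeonhole a≢b a≢c b≢c (inj₂ qa) (inj₁ pb) (inj₂ qc) = _ , _ , a≢c , inj₂ (qa , qc)

module AroundVertex {n} (G : Graph n) (critical : EdgeCritical G) (connected : Connected G ⊤)
                    (triangle-free : TriangleFree G) (v : Fin n) where
  open GraphFacts G
  open Criticality G

  K W : Subset n
  K = N G v
  W = Vv G v

  ∈K⁺ : ∀ {z} → adj G v z ≡ true → z ∈ K
  ∈K⁺ = ∈-tabulate⁺ (adj G v)

  ∈K⁻ : ∀ {z} → z ∈ K → adj G v z ≡ true
  ∈K⁻ = ∈-tabulate⁻ (adj G v)

  v∉K : v ∉ K
  v∉K v∈K = edge-non-edge (∈K⁻ v∈K) (Graph.irrefl G v)

  ∈W⁻ : ∀ {z} → z ∈ W → z ≢ v × z ∉ K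
  ∈W⁻ z∈W = (λ { refl → x∈∁p⇒x∉p z∈W (x∈p∪q⁺ (inj₁ (x∈⁅x⁆ v))) })
          , (λ z∈K → x∈∁p⇒x∉p z∈W (x∈p∪q⁺ (inj₂ z∈K)))

  v∉W : v ∉ W
  v∉W v∈W = proj₁ (∈W⁻ v∈W) refl

  K∌W : ∀ {z} → z ∈ W → z ∉ K
  K∌W = proj₂ ∘ ∈W⁻

  trichotomy : ∀ z → z ≡ v ⊎ z ∈ K ⊎ z ∈ W
  trichotomy z with z Fin.≟ v | z ∈? K
  ... | yes z≡v | _       = inj₁ z≡v
  ... | no _    | yes z∈K = inj₂ (inj₁ z∈K)
  ... | no z≢v  | no z∉K  = inj₂ (inj₂ (x∉p⇒x∈∁p λ z∈ →
          [ z≢v ∘ x∈⁅y⁆⇒x≡y v , z∉K ]′ (x∈p∪q⁻ ⁅ v ⁆ K z∈)))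

  K-independent : Independent G K
  K-independent x y x∈K y∈K = adj-false λ xy → triangle-free v x y (∈K⁻ x∈K , xy , ∈K⁻ y∈K)

  ∣T∣-split : ∀ T → ∣ T ∣ ≤ ∣ T ∩ ⁅ v ⁆ ∣ + (∣ T ∩ K ∣ + ∣ T ∩ W ∣)
  ∣T∣-split T = ≤-trans (∣p∣≤∣q∣+∣r∣ cover) (+-monoʳ-≤ ∣ T ∩ ⁅ v ⁆ ∣ (∣p∪q∣≤∣p∣+∣q∣ (T ∩ K) (T ∩ W)))
    where
    cover : ∀ {z} → z ∈ T → z ∈ T ∩ ⁅ v ⁆ ⊎ z ∈ (T ∩ K) ∪ (T ∩ W)
    cover {z} z∈T with trichotomy z
    ... | inj₁ refl        = inj₁ (x∈p∩q⁺ (z∈T , x∈⁅x⁆ v))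
    ... | inj₂ (inj₁ z∈K) = inj₂ (x∈p∪q⁺ (inj₁ (x∈p∩q⁺ (z∈T , z∈K))))
    ... | inj₂ (inj₂ z∈W) = inj₂ (x∈p∪q⁺ (inj₂ (x∈p∩q⁺ (z∈T , z∈W))))

  ∣T∩⁅v⁆∣≤1 : ∀ T → ∣ T ∩ ⁅ v ⁆ ∣ ≤ 1
  ∣T∩⁅v⁆∣≤1 T = ≤-trans (∣p∩q∣≤∣q∣ T ⁅ v ⁆) (≤-reflexive (∣⁅x⁆∣≡1 v))

  packing : ∀ {Q X} → Independent G Q → (∀ {z} → z ∈ Q → z ∉ W) →
    (∀ {x z} → x ∈ Q → adj G x z ≡ true → z ∈ X) → ∣ Q ∣ + α G (W ─ X) ≤ α G ⊤
  packing {Q} {X} Q-independent Q∌W N[Q]⊆X =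
    ≤-trans (+-monoˡ-≤ _ (α-maximal ⊆-refl Q-independent))
            (α-additive ⊆⊤ (λ z∈Q z∈W─X → Q∌W z∈Q (proj₁ (x∈p─q⁻ z∈W─X)))
                        (λ x y x∈Q y∈W─X → adj-false λ xy → proj₂ (x∈p─q⁻ y∈W─X) (N[Q]⊆X x∈Q xy)))

  α-W-lower : suc (α G W) ≤ α G ⊤
  α-W-lower = ≤-trans (+-mono-≤ (≤-reflexive (sym (∣⁅x⁆∣≡1 v))) (α-mono W⊆W─K))
                      (packing {⁅ v ⁆} {K} ⁅v⁆-independent (λ z∈⁅v⁆ → v∉W ∘ subst (_∈ W) (x∈⁅y⁆⇒x≡y v z∈⁅v⁆))
                               (λ x∈⁅v⁆ xz → ∈K⁺ (subst (λ x → adj G x _ ≡ true) (x∈⁅y⁆⇒x≡y v x∈⁅v⁆) xz)))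
    where
    W⊆W─K : W ⊆ W ─ K
    W⊆W─K z∈W = x∈p∧x∉q⇒x∈p─q z∈W (K∌W z∈W)
    ⁅v⁆-independent : Independent G ⁅ v ⁆
    ⁅v⁆-independent x y x∈ y∈
      rewrite x∈⁅y⁆⇒x≡y v x∈ | x∈⁅y⁆⇒x≡y v y∈ = Graph.irrefl G v

  packing-K : ∀ {P} → P ⊆ K → ∣ P ∣ + α G (W ─ N[ P ]) ≤ α G ⊤
  packing-K P⊆K =
    packing (independent-⊆ P⊆K K-independent) (λ z∈P z∈W → K∌W z∈W (P⊆K z∈P)) ∈N[]⁺

  -- Edge-criticality at the edge va: a largest independent set of G − va
  -- contains v and a, hence no other neighbour of v and no neighbour of a.
  single-edge : ∀ {a} → a ∈ K → α G ⊤ ≤ suc (α G (W ─ N G a))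
  single-edge {a} a∈K with critical-cut critical ⁅ v ⁆ ⁅ a ⁆ (v , a , x∈⁅x⁆ v , x∈⁅x⁆ a , ∈K⁻ a∈K)
  ... | T , cut , α<∣T∣ with (v ∈? T) ×-dec (a ∈? T)
  ...   | no ¬v,a∈T = ⊥-elim (<⇒≱ α<∣T∣ (α-maximal ⊆⊤ T-independent))
    where
    T-independent : Independent G T
    T-independent x y x∈T y∈T = cut x y x∈T y∈T λ
      { (inj₁ (x∈⁅v⁆ , y∈⁅a⁆)) → ¬v,a∈T ( subst (_∈ T) (x∈⁅y⁆⇒x≡y v x∈⁅v⁆) x∈T
                                         , subst (_∈ T) (x∈⁅y⁆⇒x≡y a y∈⁅a⁆) y∈T)
      ; (inj₂ (x∈⁅a⁆ , y∈⁅v⁆)) → ¬v,a∈T ( subst (_∈ T) (x∈⁅y⁆⇒x≡y v y∈⁅v⁆) y∈T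
                                         , subst (_∈ T) (x∈⁅y⁆⇒x≡y a x∈⁅a⁆) x∈T) }
  ...   | yes (v∈T , a∈T) = ≤-pred (≤-trans α<∣T∣ (begin
    ∣ T ∣                                     ≤⟨ ∣T∣-split T ⟩
    ∣ T ∩ ⁅ v ⁆ ∣ + (∣ T ∩ K ∣ + ∣ T ∩ W ∣)   ≤⟨ +-mono-≤ (∣T∩⁅v⁆∣≤1 T) (+-mono-≤ ∣T∩K∣≤1 ∣T∩W∣≤α) ⟩
    1 + (1 + α G (W ─ N G a))                 ∎))
    where
    open ≤-Reasoning
    a≢v : a ≢ v
    a≢v refl = v∉K a∈K
    T∩K⊆⁅a⁆ : T ∩ K ⊆ ⁅ a ⁆
    T∩K⊆⁅a⁆ {z} z∈ with x∈p∩q⁻ T K z∈ | z Fin.≟ a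
    ... | _ | yes refl = x∈⁅x⁆ a
    ... | z∈T , z∈K | no z≢a = ⊥-elim (edge-non-edge (∈K⁻ z∈K) (cut v z v∈T z∈T λ
          { (inj₁ (_ , z∈⁅a⁆)) → z≢a (x∈⁅y⁆⇒x≡y a z∈⁅a⁆)
          ; (inj₂ (v∈⁅a⁆ , _)) → a≢v (sym (x∈⁅y⁆⇒x≡y a v∈⁅a⁆)) }))
    ∣T∩K∣≤1 : ∣ T ∩ K ∣ ≤ 1
    ∣T∩K∣≤1 = ≤-trans (p⊆q⇒∣p∣≤∣q∣ T∩K⊆⁅a⁆) (≤-reflexive (∣⁅x⁆∣≡1 a))
    T∩W⊆W─N[a] : T ∩ W ⊆ W ─ N G a
    T∩W⊆W─N[a] {z} z∈ with x∈p∩q⁻ T W z∈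
    ... | z∈T , z∈W = x∈p∧x∉q⇒x∈p─q z∈W λ z∈N[a] →
          edge-non-edge (∈-tabulate⁻ (adj G a) z∈N[a]) (cut a z a∈T z∈T λ
            { (inj₁ (a∈⁅v⁆ , _)) → a≢v (x∈⁅y⁆⇒x≡y v a∈⁅v⁆)
            ; (inj₂ (_ , z∈⁅v⁆)) → v∉W (subst (_∈ W) (x∈⁅y⁆⇒x≡y v z∈⁅v⁆) z∈W) })
    ∣T∩W∣≤α : ∣ T ∩ W ∣ ≤ α G (W ─ N G a)
    ∣T∩W∣≤α = α-maximal T∩W⊆W─N[a]
                (cut-independent-inside cut λ z∈W z∈⁅v⁆ → v∉W (subst (_∈ W) (x∈⁅y⁆⇒x≡y v z∈⁅v⁆) z∈W))

  α-W-upper : ∀ {a} → a ∈ K → α G ⊤ ≤ suc (α G W)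
  α-W-upper a∈K = ≤-trans (single-edge a∈K) (s≤s (α-mono (p─q⊆p W _)))

  α-W-stable : ∀ {a} → a ∈ K → α G W ≤ α G (W ─ N G a)
  α-W-stable a∈K = ≤-pred (≤-trans α-W-lower (single-edge a∈K))

  record Split (A B : Subset n) : Set where
    field
      covers   : A ∪ B ≡ W
      disjoint : A ∩ B ≡ ⊥
      no-edge  : ∀ x y → x ∈ A → y ∈ B → adj G x y ≡ false

    A⊆W : A ⊆ W
    A⊆W x∈A = subst (_ ∈_) covers (x∈p∪q⁺ (inj₁ x∈A))

    B⊆W : B ⊆ W
    B⊆W x∈B = subst (_ ∈_) covers (x∈p∪q⁺ (inj₂ x∈B))

    W⊆A∪B : ∀ {x} → x ∈ W → x ∈ A ⊎ x ∈ B
    W⊆A∪B x∈W = x∈p∪q⁻ A B (subst (_ ∈_) (sym covers) x∈W)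

    A∌B : ∀ {x} → x ∈ A → x ∉ B
    A∌B x∈A x∈B = ∉⊥ (subst (_ ∈_) disjoint (x∈p∩q⁺ (x∈A , x∈B)))

  swap : ∀ {A B} → Split A B → Split B A
  swap {A} {B} split = record
    { covers   = trans (∪-comm B A) covers
    ; disjoint = trans (∩-comm B A) disjoint
    ; no-edge  = λ x y x∈B y∈A → adj-sym (no-edge y x y∈A x∈B) }
    where open Split split

  closed-split : ∀ {R} → R ⊆ W → (∀ {z w} → z ∈ R → w ∈ W → adj G z w ≡ true → w ∈ R) → Split R (W ─ R)
  closed-split {R} R⊆W closed = record
    { covers   = ⊆-antisym (λ z∈ → [ R⊆W , proj₁ ∘ x∈p─q⁻ ]′ (x∈p∪q⁻ R (W ─ R) z∈)) W⊆R∪W─R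
    ; disjoint = Empty-unique λ (z , z∈) →
        let z∈R , z∈W─R = x∈p∩q⁻ R (W ─ R) z∈ in proj₂ (x∈p─q⁻ z∈W─R) z∈R
    ; no-edge  = λ x y x∈R y∈W─R → adj-false λ xy →
        let y∈W , y∉R = x∈p─q⁻ y∈W─R in y∉R (closed x∈R y∈W xy) }
    where
    W⊆R∪W─R : W ⊆ R ∪ (W ─ R)
    W⊆R∪W─R {z} z∈W with z ∈? R
    ... | yes z∈R = x∈p∪q⁺ (inj₁ z∈R)
    ... | no z∉R  = x∈p∪q⁺ (inj₂ (x∈p∧x∉q⇒x∈p─q z∈W z∉R))

  α-split : ∀ {A B} → Split A B → ∀ X → α G (W ─ X) ≡ α G (A ─ X) + α G (B ─ X)
  α-split {A} {B} split X = ≤-antisym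
    (α-subadditive λ z∈W─X → let z∈W , z∉X = x∈p─q⁻ z∈W─X in
      Sum.map (λ z∈A → x∈p∧x∉q⇒x∈p─q z∈A z∉X) (λ z∈B → x∈p∧x∉q⇒x∈p─q z∈B z∉X) (W⊆A∪B z∈W))
    (α-additive
      (λ z∈ → [ (λ z∈A─X → restrict A⊆W z∈A─X) , (λ z∈B─X → restrict B⊆W z∈B─X) ]′ (x∈p∪q⁻ (A ─ X) (B ─ X) z∈))
      (λ z∈A─X z∈B─X → A∌B (proj₁ (x∈p─q⁻ z∈A─X)) (proj₁ (x∈p─q⁻ z∈B─X)))
      (λ x y x∈A─X y∈B─X → no-edge x y (proj₁ (x∈p─q⁻ x∈A─X)) (proj₁ (x∈p─q⁻ y∈B─X))))
    where
    open Split split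
    restrict : ∀ {C z} → C ⊆ W → z ∈ C ─ X → z ∈ W ─ X
    restrict C⊆W z∈C─X = let z∈C , z∉X = x∈p─q⁻ z∈C─X in x∈p∧x∉q⇒x∈p─q (C⊆W z∈C) z∉X

  α-split-W : ∀ {A B} → Split A B → α G W ≡ α G A + α G B
  α-split-W {A} {B} split = begin
    α G W                       ≡⟨ cong (α G) (sym (p─⊥≡p W)) ⟩
    α G (W ─ ⊥)                 ≡⟨ α-split split ⊥ ⟩
    α G (A ─ ⊥) + α G (B ─ ⊥)   ≡⟨ cong₂ _+_ (cong (α G) (p─⊥≡p A)) (cong (α G) (p─⊥≡p B)) ⟩
    α G A + α G B               ∎
    where open ≡-Reasoning

  edge-into : ∀ {A B} → Split A B → Nonempty B → ∃₂ λ x z → x ∈ K × z ∈ B × adj G x z ≡ true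
  edge-into {A} {B} split (y , y∈B)
    with walk-exit B (connected y v ∈⊤ ∈⊤) y∈B (v∉W ∘ Split.B⊆W split)
  ... | x , z , x∈B , z∉B , xz with trichotomy z
  ...   | inj₁ refl        = ⊥-elim (K∌W (Split.B⊆W split x∈B) (∈K⁺ (trans (Graph.sym G v x) xz)))
  ...   | inj₂ (inj₁ z∈K) = z , x , z∈K , x∈B , trans (Graph.sym G z x) xz
  ...   | inj₂ (inj₂ z∈W) with Split.W⊆A∪B split z∈W
  ...     | inj₂ z∈B = ⊥-elim (z∉B z∈B)
  ...     | inj₁ z∈A =
    ⊥-elim (edge-non-edge (trans (Graph.sym G z x) xz) (Split.no-edge split z x z∈A x∈B))

  Drops : Subset n → Subset n → Set
  Drops C X = α G (C ─ X) < α G C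

  Absorbing : Subset n → Set
  Absorbing C = ∀ P → P ⊆ K → ∣ P ∣ + α G (C ─ N[ P ]) ≤ suc (α G C)

  -- If v ∈ T, the kept edges at v keep K out of T, so T is no
  -- larger than {v} plus an independent set of G_v.
  cut-with-v : ∀ {A B T} → Split A B → CutIndependent K B T → v ∈ T → ∣ T ∣ ≤ α G ⊤
  cut-with-v {A} {B} {T} split cut v∈T = begin
    ∣ T ∣                                   ≤⟨ ∣T∣-split T ⟩
    ∣ T ∩ ⁅ v ⁆ ∣ + (∣ T ∩ K ∣ + ∣ T ∩ W ∣) ≤⟨ +-mono-≤ (∣T∩⁅v⁆∣≤1 T) (+-mono-≤ ∣T∩K∣≤0 ∣T∩W∣≤α) ⟩
    suc (α G W)                             ≤⟨ α-W-lower ⟩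
    α G ⊤                                   ∎
    where
    open Split split
    open ≤-Reasoning
    T∌K : Empty (T ∩ K)
    T∌K (z , z∈) with x∈p∩q⁻ T K z∈
    ... | z∈T , z∈K = edge-non-edge (∈K⁻ z∈K) (cut v z v∈T z∈T λ
      { (inj₁ (v∈K , _)) → v∉K v∈K
      ; (inj₂ (v∈B , _)) → v∉W (B⊆W v∈B) })
    ∣T∩K∣≤0 : ∣ T ∩ K ∣ ≤ 0
    ∣T∩K∣≤0 = ≤-reflexive (Empty⇒∣p∣≡0 T∌K)
    ∣T∩W∣≤α : ∣ T ∩ W ∣ ≤ α G W
    ∣T∩W∣≤α = α-maximal (p∩q⊆q T W) (cut-independent-inside cut K∌W)

  -- If v ∉ T, then T ∩ A avoids the neighbours of P = T ∩ K (those edges are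
  -- kept), so an absorbing A keeps T within 1 + α(G_v).
  cut-without-v : ∀ {A B T} → Split A B → CutIndependent K B T → Absorbing A → v ∉ T → ∣ T ∣ ≤ α G ⊤
  cut-without-v {A} {B} {T} split cut absorbs v∉T = begin
    ∣ T ∣                                   ≤⟨ ∣T∣-split T ⟩
    ∣ T ∩ ⁅ v ⁆ ∣ + (∣ P ∣ + ∣ T ∩ W ∣)     ≤⟨ +-mono-≤ ∣T∩⁅v⁆∣≤0 (+-monoʳ-≤ ∣ P ∣ ∣T∩W∣≤α) ⟩
    ∣ P ∣ + (α G (A ─ N[ P ]) + α G B)      ≡⟨ sym (+-assoc ∣ P ∣ _ _) ⟩
    ∣ P ∣ + α G (A ─ N[ P ]) + α G B        ≤⟨ +-monoˡ-≤ (α G B) (absorbs P (p∩q⊆q T K)) ⟩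
    suc (α G A + α G B)                     ≡⟨ cong suc (sym (α-split-W split)) ⟩
    suc (α G W)                             ≤⟨ α-W-lower ⟩
    α G ⊤                                   ∎
    where
    open Split split
    open ≤-Reasoning
    P = T ∩ K
    ∣T∩⁅v⁆∣≤0 : ∣ T ∩ ⁅ v ⁆ ∣ ≤ 0
    ∣T∩⁅v⁆∣≤0 = ≤-reflexive (Empty⇒∣p∣≡0 λ (z , z∈) →
      let z∈T , z∈⁅v⁆ = x∈p∩q⁻ T ⁅ v ⁆ z∈ in v∉T (subst (_∈ T) (x∈⁅y⁆⇒x≡y v z∈⁅v⁆) z∈T))
    T∩W⊆ : T ∩ W ⊆ (A ─ N[ P ]) ∪ B
    T∩W⊆ {z} z∈ with x∈p∩q⁻ T W z∈
    ... | z∈T , z∈W with W⊆A∪B z∈W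
    ...   | inj₂ z∈B = x∈p∪q⁺ (inj₂ z∈B)
    ...   | inj₁ z∈A = x∈p∪q⁺ (inj₁ (x∈p∧x∉q⇒x∈p─q z∈A λ z∈N[P] →
      let x , x∈P , xz = ∈N[]⁻ z∈N[P] ; x∈T , x∈K = x∈p∩q⁻ T K x∈P in
      edge-non-edge xz (cut x z x∈T z∈T λ
        { (inj₁ (_ , z∈B)) → A∌B z∈A z∈B
        ; (inj₂ (x∈B , _)) → K∌W (B⊆W x∈B) x∈K })))
    ∣T∩W∣≤α : ∣ T ∩ W ∣ ≤ α G (A ─ N[ P ]) + α G B
    ∣T∩W∣≤α = ≤-trans (α-maximal T∩W⊆ (cut-independent-inside cut K∌W)) (α-subadditive (x∈p∪q⁻ _ B))

  -- Edge-criticality at the edges between K and B: if A absorbs K and B is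
  -- nonempty, deleting those edges could not raise α.
  no-absorbing : ∀ {A B} → Split A B → Absorbing A → Nonempty B → Void
  no-absorbing split absorbs B≠∅ with critical-cut critical K _ (edge-into split B≠∅)
  ... | T , cut , α<∣T∣ with v ∈? T
  ...   | yes v∈T = <⇒≱ α<∣T∣ (cut-with-v split cut v∈T)
  ...   | no v∉T  = <⇒≱ α<∣T∣ (cut-without-v split cut absorbs v∉T)

  -- Packing and edge-criticality together: the neighbours of P ⊆ K cost the
  -- two parts at least ∣ P ∣ − 1 in total.
  budget : ∀ {A B P a} → Split A B → a ∈ K → P ⊆ K →
    ∣ P ∣ + (α G (A ─ N[ P ]) + α G (B ─ N[ P ])) ≤ suc (α G A + α G B)
  budget {A} {B} {P} split a∈K P⊆K = begin
    ∣ P ∣ + (α G (A ─ N[ P ]) + α G (B ─ N[ P ])) ≡⟨ cong (∣ P ∣ +_) (sym (α-split split N[ P ])) ⟩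
    ∣ P ∣ + α G (W ─ N[ P ])                      ≤⟨ packing-K P⊆K ⟩
    α G ⊤                                         ≤⟨ α-W-upper a∈K ⟩
    suc (α G W)                                   ≡⟨ cong suc (α-split-W split) ⟩
    suc (α G A + α G B)                           ∎
    where open ≤-Reasoning

  -- If A does not drop at N[ K ], the whole budget falls on B, which therefore absorbs K.
  absorbing-other : ∀ {A B a} → Split A B → a ∈ K → ¬ Drops A N[ K ] → Absorbing B
  absorbing-other {A} {B} {a} split a∈K ¬drop P P⊆K = +-cancelˡ-≤ (α G A) _ _ (begin
    α G A + (∣ P ∣ + α G (B ─ N[ P ]))              ≤⟨ +-monoˡ-≤ _ αA≤ ⟩
    α G (A ─ N[ P ]) + (∣ P ∣ + α G (B ─ N[ P ]))   ≡⟨ x∙yz≈y∙xz (α G (A ─ N[ P ])) ∣ P ∣ (α G (B ─ N[ P ])) ⟩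
    ∣ P ∣ + (α G (A ─ N[ P ]) + α G (B ─ N[ P ]))   ≤⟨ budget split a∈K P⊆K ⟩
    suc (α G A + α G B)                             ≡⟨ sym (+-suc (α G A) (α G B)) ⟩
    α G A + suc (α G B)                             ∎)
    where
    open ≤-Reasoning
    αA≤ : α G A ≤ α G (A ─ N[ P ])
    αA≤ = ≤-trans (≮⇒≥ ¬drop) (α-mono (─-anti A (N[]-mono P⊆K)))

  -- Every nonempty part drops at N[ K ]: otherwise the other part would
  -- absorb K although this one is nonempty.
  drops-at-K : ∀ {A B a} → Split A B → a ∈ K → Nonempty A → Drops A N[ K ]
  drops-at-K {A} split a∈K A≠∅ with α G (A ─ N[ K ]) <? α G A
  ... | yes drop = drop
  ... | no ¬drop = ⊥-elim (no-absorbing (swap split) (absorbing-other split a∈K ¬drop) A≠∅)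

  -- (a) ∣ K ∣ = 2.  With ∣ K ∣ ≤ 2 the only P ⊆ K with ∣ P ∣ ≥ 2 is K itself, so dropping at
  -- N[ K ] is all it takes to absorb K.
  absorbing-if-drops : ∀ {C} → ∣ K ∣ ≤ 2 → Drops C N[ K ] → Absorbing C
  absorbing-if-drops {C} ∣K∣≤2 drop P P⊆K with ∣ P ∣ ≤? 1
  ... | yes ∣P∣≤1 = +-mono-≤ ∣P∣≤1 (α-mono (p─q⊆p C N[ P ]))
  ... | no ∣P∣≰1 = ≤-trans (+-mono-≤ ∣P∣≤2 (α-mono (─-anti C (N[]-mono K⊆P)))) (s≤s drop)
    where
    ∣P∣≤2 : ∣ P ∣ ≤ 2
    ∣P∣≤2 = ≤-trans (p⊆q⇒∣p∣≤∣q∣ P⊆K) ∣K∣≤2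
    K⊆P : K ⊆ P
    K⊆P = ⊆-by-size P⊆K (≤-trans ∣K∣≤2 (≰⇒> ∣P∣≰1))

  no-split-deg2 : ∀ {A B} → ∣ K ∣ ≡ 2 → Split A B → Nonempty A → Nonempty B → Void
  no-split-deg2 ∣K∣≡2 split A≠∅ B≠∅ with size-nonempty ∣K∣≡2
  ... | a , a∈K = no-absorbing split
                    (absorbing-if-drops (≤-reflexive ∣K∣≡2) (drops-at-K split a∈K A≠∅)) B≠∅

  -- G_v is nonempty: otherwise α(G) ≤ 1, while the two neighbours of v are independent.
  W-nonempty : ∣ K ∣ ≡ 2 → Nonempty W
  W-nonempty ∣K∣≡2 with nonempty? W | size-nonempty ∣K∣≡2
  ... | yes W≠∅ | _ = W≠∅
  ... | no W-empty | a , a∈K = ⊥-elim (1+n≰n (begin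
    2                ≡⟨ sym ∣K∣≡2 ⟩
    ∣ K ∣            ≤⟨ α-maximal ⊆⊤ K-independent ⟩
    α G ⊤            ≤⟨ α-W-upper a∈K ⟩
    suc (α G W)      ≤⟨ s≤s (α≤∣U∣ W) ⟩
    suc ∣ W ∣         ≡⟨ cong suc (Empty⇒∣p∣≡0 W-empty) ⟩
    1                ∎))
    where open ≤-Reasoning

  -- G_v is connected: the component of x, if it missed y, would split G_v.
  W-connected : ∣ K ∣ ≡ 2 → Connected G W
  W-connected ∣K∣≡2 x y x∈W y∈W = walk-or-split (y ∈? members)
    where
    open Component (component x∈W)
    open Reachable reach
    walk-or-split : Dec (y ∈ members) → Walk G W x y
    walk-or-split (yes y∈R) = reachable y∈R
    walk-or-split (no y∉R)  = ⊥-elim (no-split-deg2 ∣K∣≡2 (closed-split ⊆U closed)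
                                        (x , ∋x) (y , x∈p∧x∉q⇒x∈p─q y∈W y∉R))

  incidences : Subset n → ℕ
  incidences C = sumOver K (λ u → ∣ N G u ∩ C ∣)

  no-single-drop : ∀ {A B a} → Split A B → a ∈ K → α G A ≤ α G (A ─ N G a)
  no-single-drop {A} {B} {a} split a∈K = +-cancelʳ-≤ (α G B) _ _ (begin
    α G A + α G B                       ≡⟨ sym (α-split-W split) ⟩
    α G W                               ≤⟨ α-W-stable a∈K ⟩
    α G (W ─ N G a)                     ≡⟨ α-split split (N G a) ⟩
    α G (A ─ N G a) + α G (B ─ N G a)   ≤⟨ +-monoʳ-≤ _ (α-mono (p─q⊆p B (N G a))) ⟩
    α G (A ─ N G a) + α G B             ∎)
    where open ≤-Reasoning

  no-small-drop : ∀ {A B Q} → Split A B → Q ⊆ K → ∣ Q ∣ ≡ 1 → α G A ≤ α G (A ─ N[ Q ])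
  no-small-drop {A} {Q = Q} split Q⊆K ∣Q∣≡1 with ∣p∣≡1⇒⊆⁅x⁆ ∣Q∣≡1
  ... | a , a∈Q , Q⊆⁅a⁆ = ≤-trans (no-single-drop split (Q⊆K a∈Q)) (α-mono (─-anti A N[Q]⊆N[a]))
    where
    N[Q]⊆N[a] : N[ Q ] ⊆ N G a
    N[Q]⊆N[a] z∈ with ∈N[]⁻ z∈
    ... | x , x∈Q , xz = ∈-tabulate⁺ (adj G a) (subst (λ x → adj G x _ ≡ true) (x∈⁅y⁆⇒x≡y a (Q⊆⁅a⁆ x∈Q)) xz)

  pair-drop : ∀ {A B w} → Split A B → ∣ K ∣ ≡ 3 → w ∈ K → Drops A N[ K - w ] ⊎ Drops B N[ K - w ]
  pair-drop {A} {B} {w} split ∣K∣≡3 w∈K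
    with α G (A ─ N[ K - w ]) <? α G A | α G (B ─ N[ K - w ]) <? α G B
  ... | yes dropA | _        = inj₁ dropA
  ... | no _      | yes dropB = inj₂ dropB
  ... | no ¬dropA | no ¬dropB = ⊥-elim (1+n≰n (begin
    2 + (α G A + α G B)
      ≤⟨ +-mono-≤ (≤-reflexive (sym ∣K-w∣≡2)) (+-mono-≤ (≮⇒≥ ¬dropA) (≮⇒≥ ¬dropB)) ⟩
    ∣ K - w ∣ + (α G (A ─ N[ K - w ]) + α G (B ─ N[ K - w ]))
      ≤⟨ budget split w∈K (p─q⊆p K ⁅ w ⁆) ⟩
    suc (α G A + α G B) ∎))
    where
    open ≤-Reasoning
    ∣K-w∣≡2 : ∣ K - w ∣ ≡ 2
    ∣K-w∣≡2 = ∣p-x∣≡k w∈K ∣K∣≡3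

  -- A stable part dropping at N[ K - y ] and N[ K - z ] (y ≢ z) has at least
  -- s + 2 incidences: y sends an edge into it (otherwise the drop at K - z
  -- would be a drop at a single vertex), and K - y already accounts for s + 1.
  two-drops : ∀ {A B s y z} → Split A B → Stable G s A → ∣ K ∣ ≡ 3 → y ∈ K → z ∈ K → y ≢ z →
    Drops A N[ K - y ] → Drops A N[ K - z ] → 2 + s ≤ incidences A
  two-drops {A} {s = s} {y} {z} split stable ∣K∣≡3 y∈K z∈K y≢z drop-y drop-z
    with 1 ≤? ∣ N G y ∩ A ∣
  ... | yes y→A = begin
    2 + s                                  ≤⟨ +-mono-≤ y→A (≤-trans (stable-bound stable drop-y)
                                                                    (∣N[P]∩C∣≤Σ (K - y) A)) ⟩
    p y + sumOver (K - y) p                ≡⟨ sym (sumOver-remove {p = K} p y∈K) ⟩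
    incidences A                           ∎
    where
    open ≤-Reasoning
    p : Fin n → ℕ
    p u = ∣ N G u ∩ A ∣
  ... | no ¬y→A = ⊥-elim (<⇒≱ drop-z (≤-trans (no-small-drop split Q⊆K ∣Q∣≡1) (α-mono A─N[Q]⊆A─N[K-z])))
    where
    Q : Subset n
    Q = K - z - y
    y∈K-z : y ∈ K - z
    y∈K-z = x∈p∧x≢y⇒x∈p-y y∈K y≢z
    Q⊆K : Q ⊆ K
    Q⊆K = p─q⊆p K ⁅ z ⁆ ∘ p─q⊆p (K - z) ⁅ y ⁆
    ∣Q∣≡1 : ∣ Q ∣ ≡ 1
    ∣Q∣≡1 = ∣p-x∣≡k y∈K-z (∣p-x∣≡k z∈K ∣K∣≡3)
    -- the neighbours of K - z in A are neighbours of Q, as y has none there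
    A─N[Q]⊆A─N[K-z] : A ─ N[ Q ] ⊆ A ─ N[ K - z ]
    A─N[Q]⊆A─N[K-z] {u} u∈ with x∈p─q⁻ u∈
    ... | u∈A , u∉N[Q] = x∈p∧x∉q⇒x∈p─q u∈A λ u∈N[K-z] → case (∈N[]⁻ u∈N[K-z])
      where
      case : (∃ λ x → x ∈ K - z × adj G x u ≡ true) → Void
      case (x , x∈K-z , xu) with x Fin.≟ y
      ... | yes refl = ¬y→A (subst (1 ≤_) (sym (∣p∣≡1+∣p-x∣ (x∈p∩q⁺ (∈-tabulate⁺ (adj G x) xu , u∈A))))
                                        (s≤s z≤n))
      ... | no x≢y = u∉N[Q] (∈N[]⁺ (x∈p∧x≢y⇒x∈p-y x∈K-z x≢y) xu)

  -- A nonempty stable part has at least s + 1 incidences, as it drops at N[ K ].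
  one-drop : ∀ {A B s a} → Split A B → a ∈ K → Nonempty A → Stable G s A → 1 + s ≤ incidences A
  one-drop {A} split a∈K A≠∅ stable =
    ≤-trans (stable-bound stable (drops-at-K split a∈K A≠∅)) (∣N[P]∩C∣≤Σ K A)

  deg-lower : ∀ {A B u} → Split A B → u ∈ K → 1 + (∣ N G u ∩ A ∣ + ∣ N G u ∩ B ∣) ≤ deg G u
  deg-lower {A} {B} {u} split u∈K = begin
    1 + (∣ N G u ∩ A ∣ + ∣ N G u ∩ B ∣)
      ≡⟨ cong₂ _+_ (sym (∣⁅x⁆∣≡1 v)) (sym (∣p∪q∣≡∣p∣+∣q∣ (N G u ∩ A) (N G u ∩ B) A∌B′)) ⟩
    ∣ ⁅ v ⁆ ∣ + ∣ (N G u ∩ A) ∪ (N G u ∩ B) ∣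
      ≡⟨ sym (∣p∪q∣≡∣p∣+∣q∣ ⁅ v ⁆ _ v∉) ⟩
    ∣ ⁅ v ⁆ ∪ ((N G u ∩ A) ∪ (N G u ∩ B)) ∣
      ≤⟨ p⊆q⇒∣p∣≤∣q∣ ⊆N[u] ⟩
    deg G u ∎
    where
    open ≤-Reasoning
    open Split split
    A∌B′ : ∀ {x} → x ∈ N G u ∩ A → x ∉ N G u ∩ B
    A∌B′ x∈ x∈′ = A∌B (proj₂ (x∈p∩q⁻ _ A x∈)) (proj₂ (x∈p∩q⁻ _ B x∈′))
    v∉ : ∀ {x} → x ∈ ⁅ v ⁆ → x ∉ (N G u ∩ A) ∪ (N G u ∩ B)
    v∉ x∈⁅v⁆ x∈ rewrite x∈⁅y⁆⇒x≡y v x∈⁅v⁆ =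
      v∉W ([ A⊆W ∘ proj₂ ∘ x∈p∩q⁻ _ A , B⊆W ∘ proj₂ ∘ x∈p∩q⁻ _ B ]′ (x∈p∪q⁻ _ _ x∈))
    ⊆N[u] : ⁅ v ⁆ ∪ ((N G u ∩ A) ∪ (N G u ∩ B)) ⊆ N G u
    ⊆N[u] x∈ with x∈p∪q⁻ ⁅ v ⁆ _ x∈
    ... | inj₁ x∈⁅v⁆ rewrite x∈⁅y⁆⇒x≡y v x∈⁅v⁆ = ∈-tabulate⁺ (adj G u) (trans (Graph.sym G u v) (∈K⁻ u∈K))
    ... | inj₂ x∈′ = [ proj₁ ∘ x∈p∩q⁻ _ A , proj₁ ∘ x∈p∩q⁻ _ B ]′ (x∈p∪q⁻ _ _ x∈′)

  d²-lower : ∀ {A B} → Split A B → ∣ K ∣ + (incidences A + incidences B) ≤ d² G v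
  d²-lower {A} {B} split = begin
    ∣ K ∣ + (incidences A + incidences B)
      ≡⟨ sym (cong₂ _+_ (sumOver-1 K) (sumOver-+ K (λ u → ∣ N G u ∩ A ∣) (λ u → ∣ N G u ∩ B ∣))) ⟩
    sumOver K (λ _ → 1) + sumOver K (λ u → ∣ N G u ∩ A ∣ + ∣ N G u ∩ B ∣)
      ≡⟨ sym (sumOver-+ K (λ _ → 1) (λ u → ∣ N G u ∩ A ∣ + ∣ N G u ∩ B ∣)) ⟩
    sumOver K (λ u → 1 + (∣ N G u ∩ A ∣ + ∣ N G u ∩ B ∣))
      ≤⟨ sumOver-mono K (deg-lower split) ⟩
    sumOver K (deg G)
      ≡⟨ sumOver-tabulate (adj G v) (deg G) ⟩
    d² G v ∎
    where open ≤-Reasoning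

  -- Two nonempty stable parts: by pigeonhole one part drops at two of the three
  -- pairs K - w, giving s + 2 incidences there and s + 1 on the other side.
  d²-bound : ∀ {A B s′ s″} → ∣ K ∣ ≡ 3 → Split A B → Nonempty A → Nonempty B →
    Stable G s′ A → Stable G s″ B → s′ + s″ + 6 ≤ d² G v
  d²-bound {A} {B} {s′} {s″} ∣K∣≡3 split A≠∅ B≠∅ stable′ stable″ with three-elements ∣K∣≡3
  ... | a , b , c , a∈K , b∈K , c∈K , a≢b , a≢c , b≢c = begin
    s′ + s″ + 6                           ≡⟨ regroup s′ s″ ⟩
    3 + (3 + (s′ + s″))                   ≤⟨ +-mono-≤ (≤-reflexive (sym ∣K∣≡3)) incidences-bound ⟩
    ∣ K ∣ + (incidences A + incidences B) ≤⟨ d²-lower split ⟩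
    d² G v                                ∎
    where
    open ≤-Reasoning
    regroup : ∀ s t → s + t + 6 ≡ 3 + (3 + (s + t))
    regroup = solve-∀
    regroup₁ : ∀ s t → 2 + s + (1 + t) ≡ 3 + (s + t)
    regroup₁ = solve-∀
    regroup₂ : ∀ s t → 1 + s + (2 + t) ≡ 3 + (s + t)
    regroup₂ = solve-∀

    DropsAt : Subset n → Fin n → Set
    DropsAt C w = w ∈ K × Drops C N[ K - w ]

    pair : ∀ {w} → w ∈ K → DropsAt A w ⊎ DropsAt B w
    pair w∈K = Sum.map (w∈K ,_) (w∈K ,_) (pair-drop split ∣K∣≡3 w∈K)

    incidences-bound : 3 + (s′ + s″) ≤ incidences A + incidences B
    incidences-bound
      with pigeonhole {P = DropsAt A} {Q = DropsAt B} a≢b a≢c b≢c (pair a∈K) (pair b∈K) (pair c∈K)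
    ... | y , z , y≢z , inj₁ ((y∈K , drop-y) , (z∈K , drop-z)) =
      subst (_≤ incidences A + incidences B) (regroup₁ s′ s″)
        (+-mono-≤ (two-drops split stable′ ∣K∣≡3 y∈K z∈K y≢z drop-y drop-z)
                  (one-drop (swap split) a∈K B≠∅ stable″))
    ... | y , z , y≢z , inj₂ ((y∈K , drop-y) , (z∈K , drop-z)) =
      subst (_≤ incidences A + incidences B) (regroup₂ s′ s″)
        (+-mono-≤ (one-drop split a∈K A≠∅ stable′)
                  (two-drops (swap split) stable″ ∣K∣≡3 y∈K z∈K y≢z drop-y drop-z))

lemma2p6 : ∀ {n} (G : Graph n) → EdgeCritical G → Connected G ⊤ → TriangleFree G →
    (v : Fin n) →
    (deg G v ≡ 2 → Nonempty (Vv G v) × Connected G (Vv G v)) ×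
    (deg G v ≡ 3 → (U′ U″ : Subset n) → (s′ s″ : ℕ) →
      U′ ∪ U″ ≡ Vv G v → U′ ∩ U″ ≡ ⊥ → Nonempty U′ → Nonempty U″ →
      (∀ x y → x ∈ U′ → y ∈ U″ → adj G x y ≡ false) →
      StronglyStable G s′ U′ → StronglyStable G s″ U″ →
      s′ + s″ + 6 ≤ d² G v)
lemma2p6 G critical connected triangle-free v =
    (λ deg≡2 → W-nonempty deg≡2 , W-connected deg≡2)
  , (λ deg≡3 U′ U″ s′ s″ covers disjoint U′≠∅ U″≠∅ no-edge stable′ stable″ →
       d²-bound deg≡3 (record { covers = covers ; disjoint = disjoint ; no-edge = no-edge })
                U′≠∅ U″≠∅ (proj₁ stable′) (proj₁ stable″))
  where open AroundVertex G critical connected triangle-free v
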